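{- (1) Let $z_1,\dots,z_q,a_1,\dots,a_m$ be pairwise distinct vertices of a graph $G$ and $z'_1,\dots,z'_q,a'_1,\dots,a'_m$ pairwise distinct vertices of a graph $G'$. Suppose that for every $i<m$ and all $a\in V(G)$, $a'\in V(G')$ such that exactly one of the equalities $a=a_{i+1}$ and $a'=a'_{i+1}$ holds, Spoiler wins $\mathrm{EHR}^k_r(G,z_1,\dots,z_q,a_i,a,G',z'_1,\dots,z'_q,a'_i,a')$. Then for every $\ell\le m$ and every $a'\in V(G')$ with $a'\ne a'_\ell$, Spoiler wins $\mathrm{EHR}^K_R(G,z_1,\dots,z_q,a_1,a_\ell,G',z'_1,\dots,z'_q,a'_1,a')$, where $K=\max\{k,q+3\}$ and $R=\lceil\log_2\ell\rceil+r$. (2) Let $t\ge1$ and let each $a_i$ and $a'_i$ (and correspondingly $a$, $a'$) denote a tuple of $t$ vertices of $G$ and $G'$ respectively. Then the statement of (1) holds with $K=\max\{k,q+3t\}$ and $R=\lceil\log_2\ell\rceil t+r$.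
   Context: The Ehrenfeucht–Fraïssé game $\mathrm{EHR}^k_r(G,v_1,\dots,v_s,G',v'_1,\dots,v'_s)$ (with $s\le k$) is played by Spoiler and Duplicator with $k$ pebbles, each in two copies; initially the $i$-th pebble's copies are on $v_i$ and $v'_i$ for $i\le s$. In each of $r$ rounds Spoiler takes a pebble, chooses one of the graphs and places (possibly moving) that copy on a vertex there; Duplicator places the other copy on a vertex of the other graph. Several pebbles may lie on one vertex. Duplicator wins if in the initial position and after each round the correspondence between the vertices of $G$ and $G'$ carrying the same pebble is a partial isomorphism (respects equality and adjacency); otherwise Spoiler wins. "Spoiler wins" means he has a strategy winning against every Duplicator strategy. For tuples, placing a tuple means placing one pebble on each of its entries. -}

module Defs where

open import Data.Nat using (ℕ; zero; suc; _≤_; _<_)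
open import Data.Fin using (Fin; toℕ; _≟_)
open import Data.Maybe using (Maybe; just; nothing)
open import Data.List using (List; []; _∷_; length; zip)
open import Data.Product using (Σ; _×_; _,_)
open import Data.Sum using (_⊎_)
open import Relation.Nullary using (¬_; Dec; yes; no)
open import Relation.Binary.PropositionalEquality using (_≡_)
open import Function.Bundles using (_⇔_)

record Graph : Set₁ where
  field
    n      : ℕ
    E      : Fin n → Fin n → Set
    E?     : ∀ u v → Dec (E u v)
    sym    : ∀ {u v} → E u v → E v u
    irrefl : ∀ {u} → ¬ E u u

open Graph public

V : Graph → Set
V G = Fin (n G)

module _ (G G' : Graph) where

  -- A position of the k-pebble game: pebble i is either off the board
  -- (nothing) or its two copies lie on (v , v') ∈ V(G) × V(G').
  Pos : ℕ → Set
  Pos k = Fin k → Maybe (V G × V G')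

  PartialIso : ∀ {k} → Pos k → Set
  PartialIso {k} p = ∀ (i j : Fin k) (a b : V G) (a' b' : V G') →
    p i ≡ just (a , a') → p j ≡ just (b , b') →
    ((a ≡ b) ⇔ (a' ≡ b')) × (E G a b ⇔ E G' a' b')

  place : ∀ {k} → Pos k → Fin k → V G → V G' → Pos k
  place p i v v' j with j ≟ i
  ... | yes _ = just (v , v')
  ... | no  _ = p j

  Wins : (k r : ℕ) → Pos k → Set
  Wins k zero    p = ¬ PartialIso p
  Wins k (suc r) p = ¬ PartialIso p ⊎
    Σ (Fin k) λ i →
        (Σ (V G)  λ v  → ∀ (v' : V G') → Wins k r (place p i v v'))
      ⊎ (Σ (V G') λ v' → ∀ (v : V G)   → Wins k r (place p i v v'))

  nth : ∀ {A : Set} → List A → ℕ → Maybe A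
  nth []       _       = nothing
  nth (x ∷ xs) zero    = just x
  nth (x ∷ xs) (suc i) = nth xs i

  initPos : (k : ℕ) → List (V G × V G') → Pos k
  initPos k xs i = nth xs (toℕ i)

SpoilerWins : (k r : ℕ) (G : Graph) → List (V G) → (G' : Graph) → List (V G') → Set
SpoilerWins k r G vs G' vs' =
  (length vs ≡ length vs') × (length vs ≤ k) ×
  Wins G G' k r (initPos G G' k (zip vs vs'))

Distinct : ∀ {m} {A : Set} → (Fin m → A) → Set
Distinct {m} f = ∀ (i j : Fin m) → f i ≡ f j → i ≡ j

{-# OPTIONS --safe #-}
module Submission where

-- Spoiler keeps pebbles on z ↦ z′ and on two blocks of t pebbles, a_i ↦ a′_i and a_j ↦ c′ with
-- c′ ≠ a′_j and i ≤ j. With a third block he pebbles a_mid for the midpoint mid of i and j. If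
-- Duplicator answers a′_mid the disagreement persists between mid and j, otherwise between i and
-- mid; the block no longer needed becomes the free one. After ⌈log₂ (ℓ + 1)⌉ such halvings either
-- i = j, and the position is no partial isomorphism, or j = i + 1, and Spoiler plays the game of
-- the hypothesis with k of the q + 3t pebbles.

open import Defs hiding (sym)
open import Data.Nat using (ℕ; zero; suc; _+_; _*_; _⊔_; _≤_; _<_; z≤n; s≤s; ⌊_/2⌋; ⌈_/2⌉)
open import Data.Nat.Properties
  using (≤-reflexive; ≤-trans; ≤-<-trans; module ≤-Reasoning; +-assoc; +-comm; +-identityʳ; +-monoʳ-≤;
         *-comm; *-zeroʳ; *-identityʳ; ∸-monoˡ-≤; m≤m+n; n≤1+n; m≤m⊔n; m≤n⊔m; m≤n⇒∃[o]m+o≡n;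
         ⌊n/2⌋≤⌈n/2⌉; ⌊n/2⌋+⌈n/2⌉≡n)
open import Data.Nat.Logarithm using (⌈log₂_⌉; ⌈log₂⌉-mono-≤; ⌈log₂⌈n/2⌉⌉≡⌈log₂n⌉∸1)
open import Data.Fin using (Fin; toℕ; zero; suc; _↑ˡ_; _↑ʳ_; splitAt; combine; remQuot; inject≤; fromℕ<; _≟_)
open import Data.Fin.Patterns using (0F; 1F; 2F)
open import Data.Fin.Properties
  using (toℕ-↑ˡ; toℕ-↑ʳ; toℕ-combine; toℕ<n; toℕ-injective; toℕ-inject≤; toℕ-fromℕ<; inject≤-injective;
         suc-injective; 0≢1+n; splitAt-↑ˡ; splitAt-↑ʳ; splitAt⁻¹-↑ˡ; splitAt⁻¹-↑ʳ; remQuot-combine; combine-remQuot)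
open import Data.Fin.Permutation.Components using (transpose; transpose-inverse)
open import Data.Maybe using (Maybe; just; nothing)
import Data.Maybe as Maybe
open import Data.List using (List; []; _∷_; tabulate; _++_; [_]; zip; length)
open import Data.List.Properties using (length-tabulate; length-++)
open import Data.Vec using (Vec; []; _∷_; lookup; toList)
open import Data.Vec.Properties using (≡-dec; length-toList; ∷-injectiveˡ)
open import Data.Vec.Membership.Propositional using (_∈_)
open import Data.Vec.Relation.Binary.Pointwise.Extensional using (Pointwise-≡⇒≡) renaming (ext to pointwise)
open import Data.Product using (Σ-syntax; _×_; _,_; proj₁; proj₂; uncurry)
open import Data.Sum using (_⊎_; inj₁; inj₂; [_,_]′)
open import Relation.Nullary using (¬_; yes; no; contradiction)
open import Relation.Binary.PropositionalEquality hiding ([_])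
open import Function using (_∘_; id)
open import Function.Definitions using (Injective)
open import Function.Bundles using (Equivalence)
open import Function.Consequences.Propositional using (inverseʳ⇒injective; strictlyInverseʳ⇒inverseʳ)

retraction⇒injective : ∀ {A B : Set} {f : A → B} (g : B → A) → (∀ x → g (f x) ≡ x) → Injective _≡_ _≡_ f
retraction⇒injective {f = f} g = inverseʳ⇒injective f ∘ strictlyInverseʳ⇒inverseʳ {f⁻¹ = g} f

midpoint : ∀ {n} (i j : Fin n) h c → toℕ j ≡ toℕ i + (h + c) →
           Σ[ mid ∈ Fin n ] toℕ mid ≡ toℕ i + h × toℕ j ≡ toℕ mid + c
midpoint i j h c j≡i+h+c = fromℕ< mid<n , toℕ-fromℕ< mid<n , j≡mid+c
  where
  mid<n : toℕ i + h < _
  mid<n = ≤-<-trans (≤-trans (+-monoʳ-≤ (toℕ i) (m≤m+n h c)) (≤-reflexive (sym j≡i+h+c))) (toℕ<n j)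
  j≡mid+c : toℕ j ≡ toℕ (fromℕ< mid<n) + c
  j≡mid+c = begin
    toℕ j                  ≡⟨ j≡i+h+c ⟩
    toℕ i + (h + c)        ≡⟨ +-assoc (toℕ i) h c ⟨
    toℕ i + h + c          ≡⟨ cong (_+ c) (toℕ-fromℕ< mid<n) ⟨
    toℕ (fromℕ< mid<n) + c ∎
    where open ≡-Reasoning

module Game (G G' : Graph) where

  place-same : ∀ {k} (p : Pos G G' k) i v v' → place G G' p i v v' i ≡ just (v , v')
  place-same p i v v' with i ≟ i
  ... | yes _   = refl
  ... | no i≢i = contradiction refl i≢i

  place-other : ∀ {k} (p : Pos G G' k) {i j} v v' → j ≢ i → place G G' p i v v' j ≡ p j
  place-other p {i} {j} v v' j≢i with j ≟ i
  ... | yes j≡i = contradiction j≡i j≢i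
  ... | no _    = refl

  Extends : ∀ {I : Set} {K} → (I → Fin K) → (I → Maybe (V G × V G')) → Pos G G' K → Set
  Extends σ p P = ∀ i {x} → p i ≡ just x → P (σ i) ≡ just x

  partialIso-restrict : ∀ {k K} {σ : Fin k → Fin K} {p P} →
                        Extends σ p P → PartialIso G G' P → PartialIso G G' p
  partialIso-restrict P⊇p iso i j a b a' b' pi pj = iso _ _ a b a' b' (P⊇p i pi) (P⊇p j pj)

  extends-place : ∀ {k K} {σ : Fin k → Fin K} → Injective _≡_ _≡_ σ → ∀ {p P} → Extends σ p P →
                  ∀ i v v' → Extends σ (place G G' p i v v') (place G G' P (σ i) v v')
  extends-place {σ = σ} σ-inj P⊇p i v v' j pj with j ≟ i
  ... | yes refl = trans (place-same _ (σ i) v v') pj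
  ... | no j≢i   = trans (place-other _ v v' (j≢i ∘ σ-inj)) (P⊇p j pj)

  wins-rename : ∀ {k K} r {σ : Fin k → Fin K} → Injective _≡_ _≡_ σ → ∀ {p P} →
                Extends σ p P → Wins G G' k r p → Wins G G' K r P
  wins-rename zero    σ-inj P⊇p ¬iso        = ¬iso ∘ partialIso-restrict P⊇p
  wins-rename (suc r) σ-inj P⊇p (inj₁ ¬iso) = inj₁ (¬iso ∘ partialIso-restrict P⊇p)
  wins-rename (suc r) {σ} σ-inj P⊇p (inj₂ (i , inj₁ (v , win))) =
    inj₂ (σ i , inj₁ (v , λ v' → wins-rename r σ-inj (extends-place σ-inj P⊇p i v v') (win v')))
  wins-rename (suc r) {σ} σ-inj P⊇p (inj₂ (i , inj₂ (v' , win))) =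
    inj₂ (σ i , inj₂ (v' , λ v → wins-rename r σ-inj (extends-place σ-inj P⊇p i v v') (win v)))

  wins-¬partialIso : ∀ {k} r {p : Pos G G' k} → ¬ PartialIso G G' p → Wins G G' k r p
  wins-¬partialIso zero    = id
  wins-¬partialIso (suc r) = inj₁

  placeAll : ∀ {k t} → Pos G G' k → (Fin t → Fin k) → Vec (V G) t → Vec (V G') t → Pos G G' k
  placeAll P js []       []         = P
  placeAll P js (v ∷ vs) (v' ∷ vs') = placeAll (place G G' P (js zero) v v') (js ∘ suc) vs vs'

  placeAll-other : ∀ {k t} P (js : Fin t → Fin k) vs vs' {j} →
                   (∀ s → js s ≢ j) → placeAll P js vs vs' j ≡ P j
  placeAll-other P js []       []         j∉js = refl
  placeAll-other P js (v ∷ vs) (v' ∷ vs') j∉js =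
    trans (placeAll-other _ (js ∘ suc) vs vs' (j∉js ∘ suc)) (place-other P v v' (j∉js zero ∘ sym))

  placeAll-lookup : ∀ {k t} P {js : Fin t → Fin k} → Injective _≡_ _≡_ js →
                    ∀ vs vs' s → placeAll P js vs vs' (js s) ≡ just (lookup vs s , lookup vs' s)
  placeAll-lookup P {js} js-inj (v ∷ vs) (v' ∷ vs') zero =
    trans (placeAll-other _ _ vs vs' (λ s → 0≢1+n ∘ sym ∘ js-inj)) (place-same P (js zero) v v')
  placeAll-lookup P js-inj (v ∷ vs) (v' ∷ vs') (suc s) =
    placeAll-lookup _ (suc-injective ∘ js-inj) vs vs' s

  wins-placeAll : ∀ {k t} r (js : Fin t → Fin k) vs P →
                  (∀ vs' → Wins G G' k r (placeAll P js vs vs')) → Wins G G' k (t + r) P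
  wins-placeAll r js []       P win = win []
  wins-placeAll r js (v ∷ vs) P win =
    inj₂ (js zero , inj₁ (v , λ v' → wins-placeAll r (js ∘ suc) vs _ (win ∘ (v' ∷_))))

module Nth (G G' : Graph) {A : Set} where

  nth-++ˡ : ∀ xs (ys : List A) {n x} → nth G G' xs n ≡ just x → nth G G' (xs ++ ys) n ≡ just x
  nth-++ˡ (x ∷ xs) ys {zero}  eq = eq
  nth-++ˡ (x ∷ xs) ys {suc n} eq = nth-++ˡ xs ys eq

  nth-++ʳ : ∀ xs {ys : List A} {l} → length xs ≡ l → ∀ n → nth G G' (xs ++ ys) (l + n) ≡ nth G G' ys n
  nth-++ʳ []       refl n = refl
  nth-++ʳ (x ∷ xs) refl n = nth-++ʳ xs refl n

  nth-length≤ : ∀ (xs : List A) {n} → length xs ≤ n → nth G G' xs n ≡ nothing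
  nth-length≤ []       _          = refl
  nth-length≤ (x ∷ xs) (s≤s len≤) = nth-length≤ xs len≤

  nth-tabulate : ∀ {q} (f : Fin q → A) x → nth G G' (tabulate f) (toℕ x) ≡ just (f x)
  nth-tabulate f zero    = refl
  nth-tabulate f (suc x) = nth-tabulate (f ∘ suc) x

  nth-toList : ∀ {t} (u : Vec A t) s → nth G G' (toList u) (toℕ s) ≡ just (lookup u s)
  nth-toList (x ∷ u) zero    = refl
  nth-toList (x ∷ u) (suc s) = nth-toList u s

  nth-zip : ∀ {B : Set} (xs : List A) (ys : List B) n →
            nth G G' (zip xs ys) n ≡ Maybe.zip (nth G G' xs n) (nth G G' ys n)
  nth-zip []       ys       n       = refl
  nth-zip (x ∷ xs) []       zero    = refl
  nth-zip (x ∷ xs) []       (suc n) with nth G G' xs n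
  ... | just _  = refl
  ... | nothing = refl
  nth-zip (x ∷ xs) (y ∷ ys) zero    = refl
  nth-zip (x ∷ xs) (y ∷ ys) (suc n) = nth-zip xs ys n

length-layout : ∀ {A : Set} {q t} (f : Fin q → A) (u v : Vec A t) →
                length (tabulate f ++ toList u ++ toList v) ≡ q + (t + t)
length-layout {q = q} {t} f u v = begin
  length (tabulate f ++ toList u ++ toList v)         ≡⟨ length-++ (tabulate f) ⟩
  length (tabulate f) + length (toList u ++ toList v) ≡⟨ cong (length (tabulate f) +_) (length-++ (toList u)) ⟩
  length (tabulate f) + (length (toList u) + length (toList v))
    ≡⟨ cong₂ _+_ (length-tabulate f) (cong₂ _+_ (length-toList u) (length-toList v)) ⟩
  q + (t + t)                                          ∎
  where open ≡-Reasoning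

module Layout (q t e : ℕ) where

  data Slot : Set where
    fixed : Fin q → Slot
    block : Fin 3 → Fin t → Slot
    spare : Fin e → Slot

  encode : Slot → Fin (q + 3 * t + e)
  encode (fixed x)   = (x ↑ˡ 3 * t) ↑ˡ e
  encode (block b s) = (q ↑ʳ combine b s) ↑ˡ e
  encode (spare x)   = (q + 3 * t) ↑ʳ x

  decode : Fin (q + 3 * t + e) → Slot
  decode n = [ [ fixed , uncurry block ∘ remQuot t ]′ ∘ splitAt q , spare ]′ (splitAt (q + 3 * t) n)

  decode-encode : ∀ sl → decode (encode sl) ≡ sl
  decode-encode (fixed x)
    rewrite splitAt-↑ˡ (q + 3 * t) (x ↑ˡ 3 * t) e | splitAt-↑ˡ q x (3 * t) = refl
  decode-encode (block b s)
    rewrite splitAt-↑ˡ (q + 3 * t) (q ↑ʳ combine b s) e | splitAt-↑ʳ q (3 * t) (combine b s)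
    = cong (uncurry block) (remQuot-combine b s)
  decode-encode (spare x)
    rewrite splitAt-↑ʳ (q + 3 * t) e x = refl

  encode-decode : ∀ n → encode (decode n) ≡ n
  encode-decode n with splitAt (q + 3 * t) n in eq
  ... | inj₂ x = splitAt⁻¹-↑ʳ eq
  ... | inj₁ y with splitAt q y in eq′
  ...   | inj₁ x = trans (cong (_↑ˡ e) (splitAt⁻¹-↑ˡ eq′)) (splitAt⁻¹-↑ˡ eq)
  ...   | inj₂ w = begin
    (q ↑ʳ uncurry combine (remQuot t w)) ↑ˡ e ≡⟨ cong (λ w → (q ↑ʳ w) ↑ˡ e) (combine-remQuot t w) ⟩
    (q ↑ʳ w) ↑ˡ e                             ≡⟨ cong (_↑ˡ e) (splitAt⁻¹-↑ʳ eq′) ⟩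
    y ↑ˡ e                                    ≡⟨ splitAt⁻¹-↑ˡ eq ⟩
    n                                         ∎
    where open ≡-Reasoning

  encode-injective : Injective _≡_ _≡_ encode
  encode-injective = retraction⇒injective decode decode-encode

  decode-injective : Injective _≡_ _≡_ decode
  decode-injective = retraction⇒injective encode encode-decode

  block-injectiveʳ : ∀ {b b' s s'} → block b s ≡ block b' s' → s ≡ s'
  block-injectiveʳ refl = refl

  relabel : (Fin 3 → Fin 3) → Slot → Slot
  relabel τ (fixed x)   = fixed x
  relabel τ (block b s) = block (τ b) s
  relabel τ (spare x)   = spare x

  relabel-inverse : ∀ {τ τ'} → (∀ b → τ' (τ b) ≡ b) → ∀ sl → relabel τ' (relabel τ sl) ≡ sl
  relabel-inverse τ'∘τ≡id (fixed x)   = refl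
  relabel-inverse τ'∘τ≡id (block b s) = cong (λ b → block b s) (τ'∘τ≡id b)
  relabel-inverse τ'∘τ≡id (spare x)   = refl

  swap-injective : ∀ b b' → Injective _≡_ _≡_ (relabel (transpose b b'))
  swap-injective b b' = retraction⇒injective (relabel (transpose b' b)) (relabel-inverse (λ _ → transpose-inverse b' b))

  slotEntry : {A : Set} → (Fin q → A) → Vec A t → Vec A t → Slot → Maybe A
  slotEntry f u v (fixed x)    = just (f x)
  slotEntry f u v (block 0F s) = just (lookup u s)
  slotEntry f u v (block 1F s) = just (lookup v s)
  slotEntry f u v (block 2F s) = nothing
  slotEntry f u v (spare x)    = nothing

  module _ (G G' : Graph) {A : Set} (f : Fin q → A) (u v : Vec A t) where
    open Nth G G'

    nth-encode : ∀ sl → nth G G' (tabulate f ++ toList u ++ toList v) (toℕ (encode sl)) ≡ slotEntry f u v sl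
    nth-encode (fixed x) rewrite toℕ-↑ˡ (x ↑ˡ 3 * t) e | toℕ-↑ˡ x (3 * t) =
      nth-++ˡ (tabulate f) _ (nth-tabulate f x)
    nth-encode (block b s) rewrite toℕ-↑ˡ (q ↑ʳ combine b s) e | toℕ-↑ʳ q (combine b s) | toℕ-combine b s =
      trans (nth-++ʳ (tabulate f) (length-tabulate f) _) (nth-block b)
      where
      nth-block : ∀ b → nth G G' (toList u ++ toList v) (t * toℕ b + toℕ s) ≡ slotEntry f u v (block b s)
      nth-block 0F rewrite *-zeroʳ t = nth-++ˡ (toList u) _ (nth-toList u s)
      nth-block 1F rewrite *-identityʳ t = trans (nth-++ʳ (toList u) (length-toList u) (toℕ s)) (nth-toList v s)
      nth-block 2F rewrite *-comm t 2 | +-identityʳ t | +-assoc t t (toℕ s) =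
        trans (nth-++ʳ (toList u) (length-toList u) (t + toℕ s))
              (nth-length≤ (toList v) (≤-trans (≤-reflexive (length-toList v)) (m≤m+n t (toℕ s))))
    nth-encode (spare x) rewrite toℕ-↑ʳ (q + 3 * t) x = nth-length≤ (tabulate f ++ toList u ++ toList v) (begin
      length (tabulate f ++ toList u ++ toList v) ≡⟨ length-layout f u v ⟩
      q + (t + t)                                 ≤⟨ +-monoʳ-≤ q (+-monoʳ-≤ t (m≤m+n t (t + 0))) ⟩
      q + 3 * t                                   ≤⟨ m≤m+n (q + 3 * t) (toℕ x) ⟩
      q + 3 * t + toℕ x                           ∎)
      where open ≤-Reasoning

module Bisection
  (G G' : Graph) {t q m k r e : ℕ}
  (z : Fin q → V G) (z' : Fin q → V G')
  (a : Fin (suc m) → Vec (V G) t) (a' : Fin (suc m) → Vec (V G') t)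
  (k≤K : k ≤ q + 3 * t + e)
  (adjacent : ∀ i j → toℕ j ≡ suc (toℕ i) → ∀ c' → c' ≢ a' j →
     Wins G G' k r (initPos G G' k (zip (tabulate z ++ toList (a i) ++ toList (a j))
                                        (tabulate z' ++ toList (a' i) ++ toList c'))))
  where

  open Game G G'
  open Nth G G'
  open Layout q t e

  K : ℕ
  K = q + 3 * t + e

  pairs : Vec (V G) t → Vec (V G') t → Vec (V G) t → Vec (V G') t → List (V G × V G')
  pairs u u' v v' = zip (tabulate z ++ toList u ++ toList v) (tabulate z' ++ toList u' ++ toList v')

  -- Blocks 0F and 1F hold the bracketing tuples u ↦ u′ and v ↦ v′; block 2F is free.
  layout : Vec (V G) t → Vec (V G') t → Vec (V G) t → Vec (V G') t → Slot → Maybe (V G × V G')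
  layout u u' v v' sl = Maybe.zip (slotEntry z u v sl) (slotEntry z' u' v' sl)

  nth-layout : ∀ u u' v v' sl → nth G G' (pairs u u' v v') (toℕ (encode sl)) ≡ layout u u' v v' sl
  nth-layout u u' v v' sl =
    trans (nth-zip (tabulate z ++ toList u ++ toList v) (tabulate z' ++ toList u' ++ toList v') _)
          (cong₂ Maybe.zip (nth-encode G G' z u v sl) (nth-encode G G' z' u' v' sl))

  repeated-block-¬partialIso : ∀ {slot : Slot → Fin K} {u u' v' P} →
                   Extends slot (layout u u' u v') P → v' ≢ u' → ¬ PartialIso G G' P
  repeated-block-¬partialIso P⊇ v'≢u' iso = v'≢u' (Pointwise-≡⇒≡ (pointwise λ s →
    Equivalence.to (proj₁ (iso _ _ _ _ _ _ (P⊇ (block 1F s) refl) (P⊇ (block 0F s) refl))) refl))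

  wins-adjacent : ∀ {slot : Slot → Fin K} → Injective _≡_ _≡_ slot → ∀ {i j c' P} →
                    toℕ j ≡ suc (toℕ i) → c' ≢ a' j →
                    Extends slot (layout (a i) (a' i) (a j) c') P → Wins G G' K r P
  wins-adjacent {slot} slot-inj {i} {j} {c'} {P} j≡1+i c'≢a'j P⊇ =
    wins-rename r (λ eq → inject≤-injective k≤K k≤K _ _ (decode-injective (slot-inj eq)))
                extends (adjacent i j j≡1+i c' c'≢a'j)
    where
    embed : Fin k → Fin K
    embed i₀ = slot (decode (inject≤ i₀ k≤K))
    extends : Extends embed (initPos G G' k (pairs (a i) (a' i) (a j) c')) P
    extends i₀ eq = P⊇ _ (begin
      layout (a i) (a' i) (a j) c' (decode (inject≤ i₀ k≤K))
        ≡⟨ nth-layout (a i) (a' i) (a j) c' _ ⟨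
      nth G G' (pairs (a i) (a' i) (a j) c') (toℕ (encode (decode (inject≤ i₀ k≤K))))
        ≡⟨ cong (nth G G' (pairs (a i) (a' i) (a j) c'))
                (trans (cong toℕ (encode-decode _)) (toℕ-inject≤ i₀ k≤K)) ⟩
      nth G G' (pairs (a i) (a' i) (a j) c') (toℕ i₀)
        ≡⟨ eq ⟩
      just _ ∎)
      where open ≡-Reasoning

  module _ {slot : Slot → Fin K} (slot-inj : Injective _≡_ _≡_ slot) {P u u' v v'}
           (P⊇ : Extends slot (layout u u' v v') P) (w : Vec (V G) t) (w' : Vec (V G') t) where

    private
      P′ : Pos G G' K
      P′ = placeAll P (slot ∘ block 2F) w w'

      unmoved : ∀ sl → (∀ s → block 2F s ≢ sl) → P′ (slot sl) ≡ P (slot sl)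
      unmoved sl sl∉free = placeAll-other P _ w w' (λ s → sl∉free s ∘ slot-inj)

      placed : ∀ s → P′ (slot (block 2F s)) ≡ just (lookup w s , lookup w' s)
      placed = placeAll-lookup P (block-injectiveʳ ∘ slot-inj) w w'

    replace-right : Extends (slot ∘ relabel (transpose 1F 2F)) (layout u u' w w') P′
    replace-right (fixed x)    eq   = trans (unmoved (fixed x) λ _ ()) (P⊇ (fixed x) eq)
    replace-right (block 0F s) eq   = trans (unmoved (block 0F s) λ _ ()) (P⊇ (block 0F s) eq)
    replace-right (block 1F s) refl = placed s
    replace-right (block 2F s) ()
    replace-right (spare x)    ()

    replace-left : Extends (slot ∘ relabel (transpose 0F 2F)) (layout w w' v v') P′
    replace-left (fixed x)    eq   = trans (unmoved (fixed x) λ _ ()) (P⊇ (fixed x) eq)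
    replace-left (block 0F s) refl = placed s
    replace-left (block 1F s) eq   = trans (unmoved (block 1F s) λ _ ()) (P⊇ (block 1F s) eq)
    replace-left (block 2F s) ()
    replace-left (spare x)    ()

  bisect : ∀ L {d} → ⌈log₂ d ⌉ ≤ L → ∀ {slot : Slot → Fin K} → Injective _≡_ _≡_ slot →
           ∀ {i j} → toℕ j ≡ toℕ i + d → ∀ {c'} → c' ≢ a' j →
           ∀ {P} → Extends slot (layout (a i) (a' i) (a j) c') P → Wins G G' K (L * t + r) P
  bisect zero {0} _ _ {i} {j} j≡i+0 c'≢a'j P⊇ with toℕ-injective (trans j≡i+0 (+-identityʳ (toℕ i)))
  ... | refl = wins-¬partialIso r (repeated-block-¬partialIso P⊇ c'≢a'j)
  bisect zero {1} _ slot-inj {i} j≡i+1 c'≢a'j P⊇ =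
    wins-adjacent slot-inj (trans j≡i+1 (+-comm (toℕ i) 1)) c'≢a'j P⊇
  bisect zero {suc (suc d)} log≤0 =
    contradiction (≤-trans (⌈log₂⌉-mono-≤ (s≤s (s≤s (z≤n {d})))) log≤0) λ ()
  bisect (suc L) {d} log≤ {slot} slot-inj {i} {j} j≡i+d {c'} c'≢a'j {P} P⊇
    with midpoint i j ⌊ d /2⌋ ⌈ d /2⌉ (trans j≡i+d (cong (toℕ i +_) (sym (⌊n/2⌋+⌈n/2⌉≡n d))))
  ... | mid , mid≡i+h , j≡mid+c =
    subst (λ R → Wins G G' K R P) (sym (+-assoc t (L * t) r))
          (wins-placeAll (L * t + r) (slot ∘ block 2F) (a mid) P answer)
    where
    log-c≤ : ⌈log₂ ⌈ d /2⌉ ⌉ ≤ L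
    log-c≤ = subst (_≤ L) (sym (⌈log₂⌈n/2⌉⌉≡⌈log₂n⌉∸1 d)) (∸-monoˡ-≤ 1 log≤)
    log-h≤ : ⌈log₂ ⌊ d /2⌋ ⌉ ≤ L
    log-h≤ = ≤-trans (⌈log₂⌉-mono-≤ (⌊n/2⌋≤⌈n/2⌉ d)) log-c≤
    answer : ∀ w' → Wins G G' K (L * t + r) (placeAll P (slot ∘ block 2F) (a mid) w')
    answer w' with ≡-dec _≟_ w' (a' mid)
    ... | yes refl = bisect L log-c≤ (swap-injective 0F 2F ∘ slot-inj) j≡mid+c c'≢a'j
                       (replace-left slot-inj P⊇ (a mid) w')
    ... | no w'≢   = bisect L log-h≤ (swap-injective 1F 2F ∘ slot-inj) mid≡i+h w'≢
                       (replace-right slot-inj P⊇ (a mid) w')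

  wins-initial : ∀ ℓ {c'} → c' ≢ a' ℓ →
    Wins G G' K (⌈log₂ (suc (toℕ ℓ)) ⌉ * t + r)
      (initPos G G' K (pairs (a 0F) (a' 0F) (a ℓ) c'))
  wins-initial ℓ c'≢a'ℓ =
    bisect _ (⌈log₂⌉-mono-≤ (n≤1+n (toℕ ℓ))) encode-injective refl c'≢a'ℓ
           (λ sl → trans (nth-layout (a 0F) (a' 0F) (a ℓ) _ sl))

spoiler-wins-by-bisection :
  ∀ (G G' : Graph) t k r q m (z : Fin q → V G) (a : Fin (suc m) → Vec (V G) t)
  (z' : Fin q → V G') (a' : Fin (suc m) → Vec (V G') t) →
  (∀ i j → toℕ j ≡ suc (toℕ i) → ∀ c' → c' ≢ a' j →
     Wins G G' k r (initPos G G' k (zip (tabulate z ++ toList (a i) ++ toList (a j))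
                                        (tabulate z' ++ toList (a' i) ++ toList c')))) →
  ∀ ℓ (c' : Vec (V G') t) → c' ≢ a' ℓ →
  SpoilerWins (k ⊔ (q + 3 * t)) (⌈log₂ (suc (toℕ ℓ)) ⌉ * t + r)
    G (tabulate z ++ toList (a 0F) ++ toList (a ℓ))
    G' (tabulate z' ++ toList (a' 0F) ++ toList c')
spoiler-wins-by-bisection G G' t k r q m z a z' a' adjacent ℓ c' c'≢a'ℓ =
  trans (length-layout z (a 0F) (a ℓ)) (sym (length-layout z' (a' 0F) c')) ,
  ≤-trans (≤-reflexive (length-layout z (a 0F) (a ℓ)))
          (≤-trans (+-monoʳ-≤ q (+-monoʳ-≤ t (m≤m+n t (t + 0)))) (m≤n⊔m k (q + 3 * t))) ,
  subst (λ K → Wins G G' K (⌈log₂ (suc (toℕ ℓ)) ⌉ * t + r) (initPos G G' K pairs)) K≡k⊔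
        (Bisection.wins-initial G G' z z' a a' k≤K adjacent ℓ c'≢a'ℓ)
  where
  pairs : List (V G × V G')
  pairs = zip (tabulate z ++ toList (a 0F) ++ toList (a ℓ)) (tabulate z' ++ toList (a' 0F) ++ toList c')
  extra : Σ[ e ∈ ℕ ] q + 3 * t + e ≡ k ⊔ (q + 3 * t)
  extra = m≤n⇒∃[o]m+o≡n (m≤n⊔m k (q + 3 * t))
  K≡k⊔ : q + 3 * t + proj₁ extra ≡ k ⊔ (q + 3 * t)
  K≡k⊔ = proj₂ extra
  k≤K : k ≤ q + 3 * t + proj₁ extra
  k≤K = subst (k ≤_) (sym K≡k⊔) (m≤m⊔n k (q + 3 * t))

lemma3 :
  -- Part (1): single vertices
  (∀ (k r q m : ℕ) (G G' : Graph)
     (z : Fin q → V G) (a : Fin (suc m) → V G)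
     (z' : Fin q → V G') (a' : Fin (suc m) → V G') →
     Distinct z → Distinct a → (∀ j i → ¬ (z j ≡ a i)) →
     Distinct z' → Distinct a' → (∀ j i → ¬ (z' j ≡ a' i)) →
     (∀ (i i₁ : Fin (suc m)) → toℕ i₁ ≡ suc (toℕ i) →
        ∀ (b : V G) (b' : V G') →
        ((b ≡ a i₁) × ¬ (b' ≡ a' i₁)) ⊎ (¬ (b ≡ a i₁) × (b' ≡ a' i₁)) →
        SpoilerWins k r G (tabulate z ++ (a i ∷ [ b ]))
                        G' (tabulate z' ++ (a' i ∷ [ b' ]))) →
     ∀ (ℓ : Fin (suc m)) (b' : V G') → ¬ (b' ≡ a' ℓ) →
     SpoilerWins (k ⊔ (q + 3)) (⌈log₂ (suc (toℕ ℓ)) ⌉ + r)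
       G (tabulate z ++ (a zero ∷ [ a ℓ ]))
       G' (tabulate z' ++ (a' zero ∷ [ b' ])))
  ×
  -- Part (2): tuples of length t ≥ 1
  (∀ (t : ℕ) → 1 ≤ t → ∀ (k r q m : ℕ) (G G' : Graph)
     (z : Fin q → V G) (a : Fin (suc m) → Vec (V G) t)
     (z' : Fin q → V G') (a' : Fin (suc m) → Vec (V G') t) →
     Distinct z → Distinct a → (∀ j i → ¬ (z j ∈ a i)) →
     Distinct z' → Distinct a' → (∀ j i → ¬ (z' j ∈ a' i)) →
     (∀ (i i₁ : Fin (suc m)) → toℕ i₁ ≡ suc (toℕ i) →
        ∀ (b : Vec (V G) t) (b' : Vec (V G') t) →
        ((b ≡ a i₁) × ¬ (b' ≡ a' i₁)) ⊎ (¬ (b ≡ a i₁) × (b' ≡ a' i₁)) →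
        SpoilerWins k r G (tabulate z ++ toList (a i) ++ toList b)
                        G' (tabulate z' ++ toList (a' i) ++ toList b')) →
     ∀ (ℓ : Fin (suc m)) (b' : Vec (V G') t) → ¬ (b' ≡ a' ℓ) →
     SpoilerWins (k ⊔ (q + 3 * t)) (⌈log₂ (suc (toℕ ℓ)) ⌉ * t + r)
       G (tabulate z ++ toList (a zero) ++ toList (a ℓ))
       G' (tabulate z' ++ toList (a' zero) ++ toList b'))
lemma3 =
  (λ k r q m G G' z a z' a' _ _ _ _ _ _ hyp ℓ b' b'≢a'ℓ →
    subst (λ R → SpoilerWins (k ⊔ (q + 3)) (R + r) G (tabulate z ++ (a zero ∷ [ a ℓ ]))
                                                 G' (tabulate z' ++ (a' zero ∷ [ b' ])))
          (*-identityʳ _)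
          (spoiler-wins-by-bisection G G' 1 k r q m z (λ i → a i ∷ []) z' (λ i → a' i ∷ [])
             (λ { i j j≡1+i (c ∷ []) c≢ →
                    proj₂ (proj₂ (hyp i j j≡1+i (a j) c (inj₁ (refl , c≢ ∘ cong (_∷ []))))) })
             ℓ (b' ∷ []) (b'≢a'ℓ ∘ ∷-injectiveˡ))) ,
  (λ t _ k r q m G G' z a z' a' _ _ _ _ _ _ hyp →
    spoiler-wins-by-bisection G G' t k r q m z a z' a'
      (λ i j j≡1+i c' c'≢ → proj₂ (proj₂ (hyp i j j≡1+i (a j) c' (inj₁ (refl , c'≢))))))
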